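{- Define the Bell numbers of the second kind $\mathrm{bel}_n$ ($n\ge 1$) by the formal power series identity \[ \log\big(1+\log(1+t)\big)=\sum_{n=1}^{\infty}\mathrm{bel}_{n}\frac{t^{n}}{n!}. \] Then for every $n\ge 1$, \[ (-1)^{n-1}\mathrm{bel}_{n}=\sum_{k=1}^{n}(k-1)!{n \brack k}, \] where ${n \brack k}$ denotes the unsigned Stirling number of the first kind.
   Context: The unsigned Stirling numbers of the first kind ${n\brack k}$ are given by $\frac{1}{k!}\big(-\log(1-t)\big)^k=\sum_{n\ge k}{n\brack k}\frac{t^n}{n!}$ (equivalently ${n\brack k}=(-1)^{n-k}S_1(n,k)$ where $\frac{1}{k!}(\log(1+t))^k=\sum_{n\ge k}S_1(n,k)\frac{t^n}{n!}$). -}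

module Defs where

open import Data.Nat using (ℕ; zero; suc; _∸_; _!)
open import Data.Integer using (+_)
open import Data.Rational using (ℚ; 0ℚ; 1ℚ; _+_; _*_; -_; _/_)

-- Formal power series over ℚ, represented by their coefficient sequences:
-- f = Σ_n f n · t^n.
PS : Set
PS = ℕ → ℚ

Σ≤ : ℕ → (ℕ → ℚ) → ℚ
Σ≤ zero    f = f zero
Σ≤ (suc n) f = Σ≤ n f + f (suc n)

Σ1to : ℕ → (ℕ → ℚ) → ℚ
Σ1to zero    f = 0ℚ
Σ1to (suc n) f = Σ1to n f + f (suc n)

_·_ : PS → PS → PS
(f · g) n = Σ≤ n (λ i → f i * g (n ∸ i))

pow : PS → ℕ → PS
pow g zero    zero    = 1ℚ
pow g zero    (suc n) = 0ℚ
pow g (suc k)         = g · pow g k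

-- composition f ∘ g, for g with zero constant term:
-- [t^n] f(g(t)) = Σ_{k=0}^{n} f_k [t^n] g(t)^k
_∘ₛ_ : PS → PS → PS
(f ∘ₛ g) n = Σ≤ n (λ k → f k * pow g k n)

sgn : ℕ → ℚ
sgn zero    = 1ℚ
sgn (suc n) = - sgn n

log1+ : PS
log1+ zero    = 0ℚ
log1+ (suc k) = sgn k * (+ 1 / suc k)

bel : ℕ → ℚ
bel n = (+ (n !) / 1) * (log1+ ∘ₛ log1+) n

-- unsigned Stirling numbers of the first kind [n k]
-- (number of permutations of n elements with k cycles), via the standard recurrence
-- [n+1, k+1] = n [n, k+1] + [n, k]
stir1 : ℕ → ℕ → ℕ
stir1 zero    zero    = 1
stir1 zero    (suc k) = 0
stir1 (suc n) zero    = 0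
stir1 (suc n) (suc k) = n Data.Nat.* stir1 n (suc k) Data.Nat.+ stir1 n k

ℕ→ℚ : ℕ → ℚ
ℕ→ℚ m = + m / 1

{-# OPTIONS --safe #-}
-- With L = log(1+t) we have (1+t)L' = 1, hence (1+t)(L^k)' = k L^(k-1).  Comparing
-- coefficients of t^n shows that n! [t^n] L^k / k! satisfies the recurrence of the signed
-- Stirling numbers of the first kind, so n! [t^n] L^k = (-1)^(n+k) k! [n k].  Substituting
-- this into log(1 + L) = Σ_k (-1)^(k-1) L^k / k gives
-- bel n = Σ_k (-1)^(k-1) (k-1)! (-1)^(n+k) [n k] = (-1)^(n-1) Σ_k (k-1)! [n k].
module Submission where

open import Defs
open import Data.Nat using (ℕ; _∸_; _≤_; _!)
open import Data.Rational using (ℚ; _*_)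
open import Relation.Binary.PropositionalEquality using (_≡_)

open import Data.Nat as ℕ using (zero; suc; z≤n)
import Data.Nat.Properties as ℕ
import Data.Integer as ℤ
import Data.Integer.Properties as ℤ
open import Data.Nat.Coprimality using (1-coprimeTo) renaming (sym to coprime-sym)
open import Data.Rational using (mkℚ; 0ℚ; 1ℚ; _+_; -_; _-_; _/_)
open import Data.Rational.Properties
  using (normalize-coprime; /-cong; *-inverseʳ; *-zeroˡ; *-zeroʳ; *-identityˡ; +-identityˡ; +-identityʳ)
open import Data.Rational.Solver using (module +-*-Solver)
open import Function using (_∘_)
open import Relation.Binary.PropositionalEquality
  using (_≗_; refl; sym; trans; cong; cong₂; module ≡-Reasoning)

open +-*-Solver

ℕ→ℚ≡mkℚ : ∀ m → ℕ→ℚ m ≡ mkℚ (ℤ.+ m) 0 (coprime-sym (1-coprimeTo m))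
ℕ→ℚ≡mkℚ m = normalize-coprime _

ℕ→ℚ-homo-+ : ∀ m n → ℕ→ℚ (m ℕ.+ n) ≡ ℕ→ℚ m + ℕ→ℚ n
ℕ→ℚ-homo-+ m n rewrite ℕ→ℚ≡mkℚ m | ℕ→ℚ≡mkℚ n =
  /-cong {p₁ = ℤ.+ (m ℕ.+ n)}
    (cong₂ ℤ._+_ (sym (ℤ.*-identityʳ (ℤ.+ m))) (sym (ℤ.*-identityʳ (ℤ.+ n)))) refl

ℕ→ℚ-homo-* : ∀ m n → ℕ→ℚ (m ℕ.* n) ≡ ℕ→ℚ m * ℕ→ℚ n
ℕ→ℚ-homo-* m n rewrite ℕ→ℚ≡mkℚ m | ℕ→ℚ≡mkℚ n = /-cong {p₁ = ℤ.+ (m ℕ.* n)} (ℤ.pos-* m n) refl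

ℕ→ℚ-*-1/ : ∀ m → ℕ→ℚ (suc m) * (ℤ.+ 1 / suc m) ≡ 1ℚ
ℕ→ℚ-*-1/ m rewrite ℕ→ℚ≡mkℚ (suc m) | normalize-coprime {1} {m} (1-coprimeTo (suc m)) =
  *-inverseʳ (mkℚ (ℤ.+ suc m) 0 (coprime-sym (1-coprimeTo (suc m))))

sgn-+ : ∀ a b → sgn (a ℕ.+ b) ≡ sgn a * sgn b
sgn-+ zero    b = sym (*-identityˡ (sgn b))
sgn-+ (suc a) b = trans (cong -_ (sgn-+ a b))
  (solve 2 (λ x y → :- (x :* y) := (:- x) :* y) refl (sgn a) (sgn b))

sgn-+-suc : ∀ a b → sgn (a ℕ.+ suc b) ≡ - sgn (a ℕ.+ b)
sgn-+-suc a b = cong sgn (ℕ.+-suc a b)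

sgn-*-self : ∀ a → sgn a * sgn a ≡ 1ℚ
sgn-*-self zero    = refl
sgn-*-self (suc a) = trans (solve 1 (λ x → (:- x) :* (:- x) := x :* x) refl (sgn a)) (sgn-*-self a)

Σ≤-cong : ∀ n {f g : ℕ → ℚ} → (∀ i → i ≤ n → f i ≡ g i) → Σ≤ n f ≡ Σ≤ n g
Σ≤-cong zero    f≡g = f≡g 0 z≤n
Σ≤-cong (suc n) f≡g =
  cong₂ _+_ (Σ≤-cong n (λ i i≤n → f≡g i (ℕ.m≤n⇒m≤1+n i≤n))) (f≡g (suc n) ℕ.≤-refl)

Σ≤-suc : ∀ n (f : ℕ → ℚ) → Σ≤ (suc n) f ≡ f 0 + Σ≤ n (f ∘ suc)
Σ≤-suc zero    f = refl
Σ≤-suc (suc n) f = trans (cong (_+ f (suc (suc n))) (Σ≤-suc n f))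
  (solve 3 (λ a b c → (a :+ b) :+ c := a :+ (b :+ c)) refl (f 0) (Σ≤ n (f ∘ suc)) (f (suc (suc n))))

Σ≤-+ : ∀ n (f g : ℕ → ℚ) → Σ≤ n (λ i → f i + g i) ≡ Σ≤ n f + Σ≤ n g
Σ≤-+ zero    f g = refl
Σ≤-+ (suc n) f g = trans (cong (_+ (f (suc n) + g (suc n))) (Σ≤-+ n f g))
  (solve 4 (λ a b c d → (a :+ b) :+ (c :+ d) := (a :+ c) :+ (b :+ d)) refl
    (Σ≤ n f) (Σ≤ n g) (f (suc n)) (g (suc n)))

*-distribˡ-Σ≤ : ∀ n c (f : ℕ → ℚ) → c * Σ≤ n f ≡ Σ≤ n (λ i → c * f i)
*-distribˡ-Σ≤ zero    c f = refl
*-distribˡ-Σ≤ (suc n) c f =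
  trans (solve 3 (λ c a b → c :* (a :+ b) := c :* a :+ c :* b) refl c (Σ≤ n f) (f (suc n)))
        (cong (_+ (c * f (suc n))) (*-distribˡ-Σ≤ n c f))

Σ≤-zero : ∀ n → Σ≤ n (λ _ → 0ℚ) ≡ 0ℚ
Σ≤-zero zero    = refl
Σ≤-zero (suc n) = cong (_+ 0ℚ) (Σ≤-zero n)

Σ1to-suc : ∀ m (f : ℕ → ℚ) → Σ1to (suc m) f ≡ Σ≤ m (f ∘ suc)
Σ1to-suc zero    f = +-identityˡ (f 1)
Σ1to-suc (suc m) f = cong (_+ f (suc (suc m))) (Σ1to-suc m f)

t· : PS → PS
t· f zero    = 0ℚ
t· f (suc n) = f n

D : PS → PS
D f n = ℕ→ℚ (suc n) * f (suc n)

[1+t]· : PS → PS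
[1+t]· f n = f n + t· f n

suc-∸ : ∀ {i n} → i ≤ n → suc n ∸ i ≡ suc (n ∸ i)
suc-∸ i≤n = ℕ.+-∸-assoc 1 i≤n

·-congˡ : ∀ {f f′ : PS} (g : PS) → f ≗ f′ → (f · g) ≗ (f′ · g)
·-congˡ g f≗f′ n = Σ≤-cong n (λ i _ → cong (_* g (n ∸ i)) (f≗f′ i))

·-congʳ : ∀ (f : PS) {g g′ : PS} → g ≗ g′ → (f · g) ≗ (f · g′)
·-congʳ f g≗g′ n = Σ≤-cong n (λ i _ → cong (f i *_) (g≗g′ (n ∸ i)))

·-distribʳ-+ : ∀ f g h n → ((λ i → f i + g i) · h) n ≡ (f · h) n + (g · h) n
·-distribʳ-+ f g h n = trans
  (Σ≤-cong n (λ i _ → solve 3 (λ a b c → (a :+ b) :* c := a :* c :+ b :* c) refl (f i) (g i) (h (n ∸ i))))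
  (Σ≤-+ n _ _)

·-distribˡ-+ : ∀ f g h n → (f · (λ i → g i + h i)) n ≡ (f · g) n + (f · h) n
·-distribˡ-+ f g h n = trans
  (Σ≤-cong n (λ i _ → solve 3 (λ a b c → a :* (b :+ c) := a :* b :+ a :* c) refl (f i) (g (n ∸ i)) (h (n ∸ i))))
  (Σ≤-+ n _ _)

·-scaleʳ : ∀ f c g n → (f · (λ i → c * g i)) n ≡ c * (f · g) n
·-scaleʳ f c g n = trans
  (Σ≤-cong n (λ i _ → solve 3 (λ a c b → a :* (c :* b) := c :* (a :* b)) refl (f i) c (g (n ∸ i))))
  (sym (*-distribˡ-Σ≤ n c _))

t·-·ˡ : ∀ f g → (t· f · g) ≗ t· (f · g)
t·-·ˡ f g zero    = *-zeroˡ (g 0)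
t·-·ˡ f g (suc n) = trans (Σ≤-suc n _)
  (trans (cong (_+ (f · g) n) (*-zeroˡ (g (suc n)))) (+-identityˡ _))

t·-·ʳ : ∀ f g → (f · t· g) ≗ t· (f · g)
t·-·ʳ f g zero    = *-zeroʳ (f 0)
t·-·ʳ f g (suc n) rewrite ℕ.n∸n≡0 n = trans
  (cong₂ _+_ (Σ≤-cong n (λ i i≤n → cong (λ x → f i * t· g x) (suc-∸ i≤n))) (*-zeroʳ (f (suc n))))
  (+-identityʳ _)

pow-zero-·ˡ : ∀ g f → (pow g 0 · f) ≗ f
pow-zero-·ˡ g f zero    = *-identityˡ (f 0)
pow-zero-·ˡ g f (suc n) = trans (Σ≤-suc n _)
  (trans (cong₂ _+_ (*-identityˡ (f (suc n)))
                    (trans (Σ≤-cong n (λ i _ → *-zeroˡ (f (n ∸ i)))) (Σ≤-zero n)))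
         (+-identityʳ _))

D-· : ∀ f g n → D (f · g) n ≡ (D f · g) n + (f · D g) n
D-· f g n = begin
    ℕ→ℚ (suc n) * Σ≤ (suc n) (λ i → f i * g (suc n ∸ i))
  ≡⟨ *-distribˡ-Σ≤ (suc n) (ℕ→ℚ (suc n)) _ ⟩
    Σ≤ (suc n) (λ i → ℕ→ℚ (suc n) * (f i * g (suc n ∸ i)))
  ≡⟨ Σ≤-cong (suc n) split ⟩
    Σ≤ (suc n) (λ i → A i + B i)
  ≡⟨ Σ≤-+ (suc n) A B ⟩
    Σ≤ (suc n) A + Σ≤ (suc n) B
  ≡⟨ cong₂ _+_ ΣA ΣB ⟩
    (D f · g) n + (f · D g) n
  ∎
  where
  open ≡-Reasoning
  A B : ℕ → ℚ
  A i = ℕ→ℚ i * f i * g (suc n ∸ i)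
  B i = f i * (ℕ→ℚ (suc n ∸ i) * g (suc n ∸ i))
  split : ∀ i → i ≤ suc n → ℕ→ℚ (suc n) * (f i * g (suc n ∸ i)) ≡ A i + B i
  split i i≤sn = trans (cong (λ x → ℕ→ℚ x * (f i * g (suc n ∸ i))) (sym (ℕ.m+[n∸m]≡n i≤sn)))
    (trans (cong (_* (f i * g (suc n ∸ i))) (ℕ→ℚ-homo-+ i (suc n ∸ i)))
      (solve 4 (λ a b x y → (a :+ b) :* (x :* y) := a :* x :* y :+ x :* (b :* y)) refl
        (ℕ→ℚ i) (ℕ→ℚ (suc n ∸ i)) (f i) (g (suc n ∸ i))))
  ΣA : Σ≤ (suc n) A ≡ (D f · g) n
  ΣA = trans (Σ≤-suc n A)
    (trans (cong (_+ Σ≤ n (A ∘ suc)) (trans (cong (_* g (suc n)) (*-zeroˡ (f 0))) (*-zeroˡ (g (suc n)))))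
      (+-identityˡ _))
  ΣB : Σ≤ (suc n) B ≡ (f · D g) n
  ΣB rewrite ℕ.n∸n≡0 n = trans
    (cong₂ _+_ (Σ≤-cong n (λ i i≤n → cong (λ x → f i * (ℕ→ℚ x * g x)) (suc-∸ i≤n)))
               (trans (cong (f (suc n) *_) (*-zeroˡ (g 0))) (*-zeroʳ (f (suc n)))))
    (+-identityʳ _)

[1+t]·-cong : ∀ {f g : PS} → f ≗ g → [1+t]· f ≗ [1+t]· g
[1+t]·-cong f≗g zero    = cong (_+ 0ℚ) (f≗g 0)
[1+t]·-cong f≗g (suc n) = cong₂ _+_ (f≗g (suc n)) (f≗g n)

[1+t]·-+ : ∀ f g n → [1+t]· (λ i → f i + g i) n ≡ [1+t]· f n + [1+t]· g n
[1+t]·-+ f g zero    = solve 2 (λ a b → (a :+ b) :+ con 0ℚ := (a :+ con 0ℚ) :+ (b :+ con 0ℚ)) refl (f 0) (g 0)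
[1+t]·-+ f g (suc n) = solve 4 (λ a b c d → (a :+ b) :+ (c :+ d) := (a :+ c) :+ (b :+ d)) refl
  (f (suc n)) (g (suc n)) (f n) (g n)

[1+t]·-·ˡ : ∀ f g → [1+t]· (f · g) ≗ ([1+t]· f · g)
[1+t]·-·ˡ f g n = sym (trans (·-distribʳ-+ f (t· f) g n) (cong ((f · g) n +_) (t·-·ˡ f g n)))

[1+t]·-·ʳ : ∀ f g → [1+t]· (f · g) ≗ (f · [1+t]· g)
[1+t]·-·ʳ f g n = sym (trans (·-distribˡ-+ f g (t· g) n) (cong ((f · g) n +_) (t·-·ʳ f g n)))

[1+t]·-D-pow : ∀ g → [1+t]· (D g) ≗ pow g 0 →
               ∀ k n → [1+t]· (D (pow g k)) n ≡ ℕ→ℚ k * pow g (k ∸ 1) n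
[1+t]·-D-pow g g′ zero    zero    = *-zeroʳ 1ℚ
[1+t]·-D-pow g g′ zero    (suc n) = solve 3 (λ a b x → a :* con 0ℚ :+ b :* con 0ℚ := con 0ℚ :* x) refl
  (ℕ→ℚ (suc (suc n))) (ℕ→ℚ (suc n)) (pow g 0 (suc n))
[1+t]·-D-pow g g′ (suc k) n = begin
    [1+t]· (D (g · gᵏ)) n
  ≡⟨ [1+t]·-cong (D-· g gᵏ) n ⟩
    [1+t]· (λ i → (D g · gᵏ) i + (g · D gᵏ) i) n
  ≡⟨ [1+t]·-+ (D g · gᵏ) (g · D gᵏ) n ⟩
    [1+t]· (D g · gᵏ) n + [1+t]· (g · D gᵏ) n
  ≡⟨ cong₂ _+_ (trans ([1+t]·-·ˡ (D g) gᵏ n) (trans (·-congˡ gᵏ g′ n) (pow-zero-·ˡ g gᵏ n)))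
               (trans ([1+t]·-·ʳ g (D gᵏ) n)
                      (trans (·-congʳ g ([1+t]·-D-pow g g′ k) n) (·-scaleʳ g (ℕ→ℚ k) (pow g (k ∸ 1)) n))) ⟩
    gᵏ n + ℕ→ℚ k * (g · pow g (k ∸ 1)) n
  ≡⟨ cong (gᵏ n +_) (absorb k) ⟩
    gᵏ n + ℕ→ℚ k * gᵏ n
  ≡⟨ trans (solve 2 (λ a x → x :+ a :* x := (con 1ℚ :+ a) :* x) refl (ℕ→ℚ k) (gᵏ n))
           (cong (_* gᵏ n) (sym (ℕ→ℚ-homo-+ 1 k))) ⟩
    ℕ→ℚ (suc k) * gᵏ n
  ∎
  where
  open ≡-Reasoning
  gᵏ : PS
  gᵏ = pow g k
  absorb : ∀ k → ℕ→ℚ k * (g · pow g (k ∸ 1)) n ≡ ℕ→ℚ k * pow g k n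
  absorb zero    = trans (*-zeroˡ ((g · pow g 0) n)) (sym (*-zeroˡ (pow g 0 n)))
  absorb (suc j) = refl

L^_ : ℕ → PS
L^ k = pow log1+ k

D-log1+ : D log1+ ≗ sgn
D-log1+ n = trans
  (solve 3 (λ a s b → a :* (s :* b) := s :* (a :* b)) refl (ℕ→ℚ (suc n)) (sgn n) (ℤ.+ 1 / suc n))
  (trans (cong (sgn n *_) (ℕ→ℚ-*-1/ n)) (solve 1 (λ s → s :* con 1ℚ := s) refl (sgn n)))

[1+t]·-D-log1+ : [1+t]· (D log1+) ≗ L^ 0
[1+t]·-D-log1+ zero    = cong (_+ 0ℚ) (D-log1+ 0)
[1+t]·-D-log1+ (suc n) = trans (cong₂ _+_ (D-log1+ (suc n)) (D-log1+ n))
  (solve 1 (λ s → :- s :+ s := con 0ℚ) refl (sgn n))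

L^-recurrence : ∀ j m → ℕ→ℚ (suc m) * (L^ suc j) (suc m) + ℕ→ℚ m * (L^ suc j) m
                        ≡ ℕ→ℚ (suc j) * (L^ j) m
L^-recurrence j zero    = trans (cong (ℕ→ℚ 1 * (L^ suc j) 1 +_) (*-zeroˡ ((L^ suc j) 0)))
                                ([1+t]·-D-pow log1+ [1+t]·-D-log1+ (suc j) 0)
L^-recurrence j (suc m) = [1+t]·-D-pow log1+ [1+t]·-D-log1+ (suc j) (suc m)

factorial-L^-recurrence : ∀ j m →
  ℕ→ℚ (suc m !) * (L^ suc j) (suc m) + ℕ→ℚ m * (ℕ→ℚ (m !) * (L^ suc j) m)
    ≡ ℕ→ℚ (suc j) * (ℕ→ℚ (m !) * (L^ j) m)
factorial-L^-recurrence j m = begin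
    ℕ→ℚ (suc m ℕ.* m !) * X + b * (F * Y)
  ≡⟨ cong (λ u → u * X + b * (F * Y)) (ℕ→ℚ-homo-* (suc m) (m !)) ⟩
    a * F * X + b * (F * Y)
  ≡⟨ solve 5 (λ a b F X Y → a :* F :* X :+ b :* (F :* Y) := F :* (a :* X :+ b :* Y)) refl a b F X Y ⟩
    F * (a * X + b * Y)
  ≡⟨ cong (F *_) (L^-recurrence j m) ⟩
    F * (c * Z)
  ≡⟨ solve 3 (λ F c Z → F :* (c :* Z) := c :* (F :* Z)) refl F c Z ⟩
    c * (F * Z)
  ∎
  where
  open ≡-Reasoning
  X = (L^ suc j) (suc m)
  Y = (L^ suc j) m
  Z = (L^ j) m
  F = ℕ→ℚ (m !)
  a = ℕ→ℚ (suc m)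
  b = ℕ→ℚ m
  c = ℕ→ℚ (suc j)

factorial-L^≡stir1 : ∀ n k → ℕ→ℚ (n !) * (L^ k) n ≡ ℕ→ℚ (k !) * (sgn (n ℕ.+ k) * ℕ→ℚ (stir1 n k))
factorial-L^≡stir1 zero    zero    = refl
factorial-L^≡stir1 zero    (suc j) = trans (cong (ℕ→ℚ 1 *_) (*-zeroˡ ((L^ j) 0)))
  (solve 2 (λ x s → con 1ℚ :* con 0ℚ := x :* (s :* con 0ℚ)) refl (ℕ→ℚ (suc j !)) (sgn (suc j)))
factorial-L^≡stir1 (suc m) zero    = solve 2 (λ x s → x :* con 0ℚ := con 1ℚ :* (s :* con 0ℚ)) refl
  (ℕ→ℚ (suc m !)) (sgn (suc m ℕ.+ 0))
factorial-L^≡stir1 (suc m) (suc j) = begin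
    ℕ→ℚ (suc m !) * (L^ suc j) (suc m)
  ≡⟨ solve 2 (λ x y → x := (x :+ y) :- y) refl (ℕ→ℚ (suc m !) * (L^ suc j) (suc m)) (b * (F * Y)) ⟩
    ℕ→ℚ (suc m !) * (L^ suc j) (suc m) + b * (F * Y) - b * (F * Y)
  ≡⟨ cong (_- b * (F * Y)) (factorial-L^-recurrence j m) ⟩
    c * (F * Z) - b * (F * Y)
  ≡⟨ cong₂ (λ u v → c * u - b * v) (factorial-L^≡stir1 m j) (factorial-L^≡stir1 m (suc j)) ⟩
    c * (J * (σ * S₀)) - b * (ℕ→ℚ (suc j !) * (sgn (m ℕ.+ suc j) * S₁))
  ≡⟨ cong₂ (λ u v → c * (J * (σ * S₀)) - b * (u * (v * S₁))) (ℕ→ℚ-homo-* (suc j) (j !)) (sgn-+-suc m j) ⟩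
    c * (J * (σ * S₀)) - b * ((c * J) * (- σ * S₁))
  ≡⟨ solve 6 (λ c J σ S₀ b S₁ → c :* (J :* (σ :* S₀)) :- b :* ((c :* J) :* (:- σ :* S₁))
                                 := (c :* J) :* (:- (:- σ) :* (b :* S₁ :+ S₀))) refl c J σ S₀ b S₁ ⟩
    (c * J) * (- (- σ) * (b * S₁ + S₀))
  ≡⟨ sym (cong₂ (λ u v → u * (v * (b * S₁ + S₀))) (ℕ→ℚ-homo-* (suc j) (j !)) (cong -_ (sgn-+-suc m j))) ⟩
    ℕ→ℚ (suc j !) * (sgn (suc m ℕ.+ suc j) * (b * S₁ + S₀))
  ≡⟨ sym (cong (λ w → ℕ→ℚ (suc j !) * (sgn (suc m ℕ.+ suc j) * w)) stir1-suc) ⟩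
    ℕ→ℚ (suc j !) * (sgn (suc m ℕ.+ suc j) * ℕ→ℚ (stir1 (suc m) (suc j)))
  ∎
  where
  open ≡-Reasoning
  Y = (L^ suc j) m
  Z = (L^ j) m
  F = ℕ→ℚ (m !)
  b = ℕ→ℚ m
  c = ℕ→ℚ (suc j)
  J = ℕ→ℚ (j !)
  σ = sgn (m ℕ.+ j)
  S₀ = ℕ→ℚ (stir1 m j)
  S₁ = ℕ→ℚ (stir1 m (suc j))
  stir1-suc : ℕ→ℚ (stir1 (suc m) (suc j)) ≡ b * S₁ + S₀
  stir1-suc = trans (ℕ→ℚ-homo-+ (m ℕ.* stir1 m (suc j)) (stir1 m j))
                    (cong (_+ S₀) (ℕ→ℚ-homo-* m (stir1 m (suc j))))

bel-summand : ∀ m j →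
  sgn m * (ℕ→ℚ (suc m !) * (log1+ (suc j) * (L^ suc j) (suc m)))
    ≡ ℕ→ℚ (j !) * ℕ→ℚ (stir1 (suc m) (suc j))
bel-summand m j = begin
    σₘ * (N * (σⱼ * ι * X))
  ≡⟨ solve 5 (λ σₘ N σⱼ ι X → σₘ :* (N :* (σⱼ :* ι :* X)) := σₘ :* (σⱼ :* ι) :* (N :* X)) refl σₘ N σⱼ ι X ⟩
    σₘ * (σⱼ * ι) * (N * X)
  ≡⟨ cong (σₘ * (σⱼ * ι) *_) (factorial-L^≡stir1 (suc m) (suc j)) ⟩
    σₘ * (σⱼ * ι) * (ℕ→ℚ (suc j ℕ.* j !) * (sgn (suc m ℕ.+ suc j) * S))
  ≡⟨ cong₂ (λ u v → σₘ * (σⱼ * ι) * (u * (v * S))) (ℕ→ℚ-homo-* (suc j) (j !)) sgn-sum ⟩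
    σₘ * (σⱼ * ι) * ((c * J) * ((σₘ * σⱼ) * S))
  ≡⟨ solve 6 (λ σₘ σⱼ ι c J S → σₘ :* (σⱼ :* ι) :* ((c :* J) :* ((σₘ :* σⱼ) :* S))
                                := (σₘ :* σₘ) :* (σⱼ :* σⱼ) :* (c :* ι) :* (J :* S)) refl σₘ σⱼ ι c J S ⟩
    (σₘ * σₘ) * (σⱼ * σⱼ) * (c * ι) * (J * S)
  ≡⟨ cong₂ (λ u w → u * w * (J * S)) (cong₂ _*_ (sgn-*-self m) (sgn-*-self j)) (ℕ→ℚ-*-1/ j) ⟩
    1ℚ * 1ℚ * 1ℚ * (J * S)
  ≡⟨ solve 1 (λ x → con 1ℚ :* con 1ℚ :* con 1ℚ :* x := x) refl (J * S) ⟩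
    J * S
  ∎
  where
  open ≡-Reasoning
  σₘ = sgn m
  σⱼ = sgn j
  N = ℕ→ℚ (suc m !)
  X = (L^ suc j) (suc m)
  ι = ℤ.+ 1 / suc j
  c = ℕ→ℚ (suc j)
  J = ℕ→ℚ (j !)
  S = ℕ→ℚ (stir1 (suc m) (suc j))
  sgn-sum : sgn (suc m ℕ.+ suc j) ≡ σₘ * σⱼ
  sgn-sum = trans (cong -_ (sgn-+-suc m j))
    (trans (solve 1 (λ x → :- (:- x) := x) refl (sgn (m ℕ.+ j))) (sgn-+ m j))

theorem1 : (n : ℕ) → 1 ≤ n →
             sgn (n ∸ 1) * bel n
               ≡ Σ1to n (λ k → ℕ→ℚ ((k ∸ 1) !) * ℕ→ℚ (stir1 n k))
theorem1 (suc m) _ = begin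
    sgn m * (N * Σ≤ (suc m) T)
  ≡⟨ cong (sgn m *_) (trans (*-distribˡ-Σ≤ (suc m) N T) (Σ≤-suc m (λ k → N * T k))) ⟩
    sgn m * (N * T 0 + Σ≤ m (λ j → N * T (suc j)))
  ≡⟨ cong (λ w → sgn m * (w + Σ≤ m (λ j → N * T (suc j))))
          (trans (cong (N *_) (*-zeroˡ ((L^ 0) (suc m)))) (*-zeroʳ N)) ⟩
    sgn m * (0ℚ + Σ≤ m (λ j → N * T (suc j)))
  ≡⟨ trans (cong (sgn m *_) (+-identityˡ _)) (*-distribˡ-Σ≤ m (sgn m) _) ⟩
    Σ≤ m (λ j → sgn m * (N * T (suc j)))
  ≡⟨ Σ≤-cong m (λ j _ → bel-summand m j) ⟩
    Σ≤ m (λ j → ℕ→ℚ (j !) * ℕ→ℚ (stir1 (suc m) (suc j)))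
  ≡⟨ sym (Σ1to-suc m (λ k → ℕ→ℚ ((k ∸ 1) !) * ℕ→ℚ (stir1 (suc m) k))) ⟩
    Σ1to (suc m) (λ k → ℕ→ℚ ((k ∸ 1) !) * ℕ→ℚ (stir1 (suc m) k))
  ∎
  where
  open ≡-Reasoning
  N = ℕ→ℚ (suc m !)
  T : ℕ → ℚ
  T k = log1+ k * (L^ k) (suc m)
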